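{- For $n\ge1$, the number of equivalence classes into which $S_n$ is partitioned under general $\{\{123,132,213\}\}$-equivalence is $2^{n-1}$.
   Context: Permutations are written as words $\pi_1\cdots\pi_n$. A sequence of distinct integers $a_1a_2a_3$ has pattern $\sigma\in S_3$ if $a_s<a_t\iff\sigma_s<\sigma_t$. A general move on $\pi\in S_n$ chooses any positions $i_1<i_2<i_3$ with $\pi_{i_1}\pi_{i_2}\pi_{i_3}$ of pattern $\sigma\in\{123,132,213\}$ and rearranges these three values in these positions to have a pattern $\sigma'\in\{123,132,213\}$. Equivalence is the equivalence relation generated by such moves. -}

module Defs where

open import Data.Nat using (ℕ)
open import Data.Fin using (Fin; _<_)
open import Data.Vec using (Vec; lookup)
open import Data.List using (List; []; _∷_)
open import Data.Product using (_×_; ∃-syntax)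
open import Data.Sum using (_⊎_)
open import Relation.Binary.PropositionalEquality using (_≡_; _≢_)
open import Relation.Binary.Construct.Closure.Equivalence using (EqClosure)
open import Data.List.Relation.Binary.Permutation.Propositional using (_↭_)

-- A word of length n over the letters Fin n; a permutation π₁⋯πₙ ∈ Sₙ is such
-- a word whose letters are distinct (values are 0-based: Fin n = {0,…,n-1}).
Word : ℕ → Set
Word n = Vec (Fin n) n

IsPerm : {n : ℕ} → Word n → Set
IsPerm {n} w = (i j : Fin n) → lookup w i ≡ lookup w j → i ≡ j

Pat123 Pat132 Pat213 : {n : ℕ} → Fin n → Fin n → Fin n → Set
Pat123 a b c = (a < b) × (b < c)
Pat132 a b c = (a < c) × (c < b)
Pat213 a b c = (b < a) × (a < c)

InΠ : {n : ℕ} → Fin n → Fin n → Fin n → Set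
InΠ a b c = Pat123 a b c ⊎ Pat132 a b c ⊎ Pat213 a b c

Move : {n : ℕ} → Word n → Word n → Set
Move {n} w w′ =
  ∃[ i ] ∃[ j ] ∃[ k ]
    ( (i < j) × (j < k)
    × InΠ (lookup w i) (lookup w j) (lookup w k)
    × InΠ (lookup w′ i) (lookup w′ j) (lookup w′ k)
    × ((lookup w′ i ∷ lookup w′ j ∷ lookup w′ k ∷ []) ↭ (lookup w i ∷ lookup w j ∷ lookup w k ∷ []))
    × ((p : Fin n) → p ≢ i → p ≢ j → p ≢ k → lookup w′ p ≡ lookup w p) )

Equiv : {n : ℕ} → Word n → Word n → Set
Equiv = EqClosure Move

module Submission where

-- The classes are classified by cuts.  A permutation w has a cut at c when every
-- letter before position c exceeds every letter from position c on.
--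
-- (1) Cuts are invariants.  All three patterns 123, 132, 213 have first letter
--     smaller than last letter, so the window of a move never straddles a cut, and
--     a move only permutes letters inside its window.
-- (2) Representatives.  For every bit-vector bs of length n-1, rep builds a
--     permutation (decreasing blocks of increasing runs) whose cuts are exactly the
--     positions c = i+1 with bit i set; by (1) distinct bit-vectors give
--     inequivalent representatives.
-- (3) Every permutation is equivalent to a representative.  Swapping an inversion
--     j<k that is the "32" of a 132 or the "21" of a 213 is a move making the word
--     lexicographically smaller, so swapping terminates in an irreducible
--     permutation.  In an irreducible permutation every inversion is separated by
--     a cut ("layered"), and by induction on the length a layered permutation is
--     the representative of its cuts.

open import Defs
open import Data.Nat using (ℕ; zero; suc; _+_; _≤_; _<_; _∸_; _^_; z≤n; s≤s)
import Data.Nat.Properties as NP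
open import Data.Fin using (Fin; toℕ; fromℕ; fromℕ<; inject₁; punchIn; punchOut) renaming (zero to fz; suc to fs)
import Data.Fin as F
import Data.Fin.Properties as FP
import Data.Fin.Induction as FI
open import Data.Fin.Permutation.Components using (transpose; transpose-inverse)
open import Data.Bool using (Bool; true; false)
open import Data.Vec using (Vec; []; _∷_; lookup; tabulate; map)
import Data.Vec.Properties as VP
open import Data.Vec.Relation.Binary.Pointwise.Extensional using (ext; Pointwise-≡⇒≡)
open import Data.Vec.Relation.Binary.Lex.Strict using (Lex-<; this; next)
import Data.Vec.Relation.Binary.Lex.Strict as Lex
open import Data.List using (List; length; _++_)
import Data.List as L
open import Data.List.Properties using (length-map; length-++)
open import Data.List.Membership.Propositional using (_∈_)
open import Data.List.Relation.Unary.All using (All)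
import Data.List.Relation.Unary.All as All
import Data.List.Relation.Unary.All.Properties as AllP
open import Data.List.Relation.Unary.Any using (Any; here; there)
import Data.List.Relation.Unary.Any as Any
import Data.List.Relation.Unary.Any.Properties as AnyP
open import Data.List.Relation.Unary.AllPairs using (AllPairs)
import Data.List.Relation.Unary.AllPairs as AP
import Data.List.Relation.Unary.AllPairs.Properties as APP
open import Data.List.Relation.Binary.Permutation.Propositional using (_↭_; ↭-sym; ↭-refl; prep; swap)
open import Data.List.Relation.Binary.Permutation.Propositional.Properties using (∈-resp-↭)
open import Data.Product using (Σ; _×_; _,_; ∃-syntax)
open import Data.Sum using (_⊎_; inj₁; inj₂)
open import Data.Empty using (⊥-elim)
open import Function.Definitions using (Injective)
open import Induction.WellFounded using (Acc; acc; WellFounded)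
open import Relation.Nullary using (¬_; Dec; yes; no)
open import Relation.Nullary.Decidable using (_×-dec_; _⊎-dec_; dec-true; dec-false)
open import Relation.Binary.Definitions using (tri<; tri≈; tri>)
open import Relation.Binary.PropositionalEquality using (_≡_; _≢_; refl; sym; trans; cong; cong₂; subst; subst₂; module ≡-Reasoning)
open import Relation.Binary.Construct.Closure.ReflexiveTransitive using (ε; _◅_)
open import Relation.Binary.Construct.Closure.Symmetric using (SymClosure; fwd; bwd)
open import Relation.Binary.Construct.Closure.Equivalence using (symmetric)

private
  variable
    k n : ℕ

perm-flip : {w : Word n} → IsPerm w → {p q : Fin n} → p ≢ q →
  ¬ (lookup w p F.< lookup w q) → lookup w q F.< lookup w p
perm-flip pw {p} {q} p≢q ≮ = FP.≤∧≢⇒< (NP.≮⇒≥ ≮) (λ e → p≢q (pw p q (sym e)))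

-- A permutation word uses every letter (pigeonhole: otherwise it would inject
-- Fin n into Fin (n-1)).
perm-surjective : {w : Word n} → IsPerm w → (v : Fin n) → ∃[ p ] lookup w p ≡ v
perm-surjective {suc n} {w} pw v with FP.any? (λ p → lookup w p FP.≟ v)
... | yes hit = hit
... | no miss = ⊥-elim (FP.<⇒notInjective (NP.n<1+n n) squeeze-injective)
  where
    squeeze : Fin (suc n) → Fin n
    squeeze p = punchOut {i = v} (λ e → miss (p , sym e))
    squeeze-injective : Injective _≡_ _≡_ squeeze
    squeeze-injective {p} {q} e =
      pw p q (FP.punchOut-injective (λ e′ → miss (p , sym e′)) (λ e′ → miss (q , sym e′)) e)

toℕ-punchIn-< : (i : Fin (suc k)) (j : Fin k) → toℕ j < toℕ i → toℕ (punchIn i j) ≡ toℕ j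
toℕ-punchIn-< fz j ()
toℕ-punchIn-< (fs i) fz _ = refl
toℕ-punchIn-< (fs i) (fs j) (s≤s j<i) = cong suc (toℕ-punchIn-< i j j<i)

toℕ-punchIn-≥ : (i : Fin (suc k)) (j : Fin k) → toℕ i ≤ toℕ j → toℕ (punchIn i j) ≡ suc (toℕ j)
toℕ-punchIn-≥ fz j _ = refl
toℕ-punchIn-≥ (fs i) fz ()
toℕ-punchIn-≥ (fs i) (fs j) (s≤s i≤j) = cong suc (toℕ-punchIn-≥ i j i≤j)

punchIn-below : (i : Fin (suc k)) (j : Fin k) → toℕ j < toℕ i → punchIn i j F.< i
punchIn-below i j j<i = subst (_< toℕ i) (sym (toℕ-punchIn-< i j j<i)) j<i

punchIn-above : (i : Fin (suc k)) (j : Fin k) → toℕ i ≤ toℕ j → i F.< punchIn i j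
punchIn-above i j i≤j = subst (toℕ i <_) (sym (toℕ-punchIn-≥ i j i≤j)) (s≤s i≤j)

punchIn-mono-< : (i : Fin (suc k)) {a b : Fin k} → a F.< b → punchIn i a F.< punchIn i b
punchIn-mono-< i {a} {b} a<b = NP.≰⇒> (λ pb≤pa → NP.<⇒≱ a<b (FP.punchIn-cancel-≤ i b a pb≤pa))

punchIn-cancel-< : (i : Fin (suc k)) {a b : Fin k} → punchIn i a F.< punchIn i b → a F.< b
punchIn-cancel-< i {a} {b} lt = NP.≰⇒> (λ b≤a → NP.<⇒≱ lt (FP.punchIn-mono-≤ i b a b≤a))

Cut : Word n → ℕ → Set
Cut {n} w c = (p q : Fin n) → toℕ p < c → c ≤ toℕ q → lookup w q F.< lookup w p

move-sym : {w w′ : Word n} → Move w w′ → Move w′ w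
move-sym (i , j , k , i<j , j<k , P , P′ , w′↭w , rest) =
  i , j , k , i<j , j<k , P′ , P , ↭-sym w′↭w , λ p p≢i p≢j p≢k → sym (rest p p≢i p≢j p≢k)

first<last : {a b c : Fin n} → InΠ a b c → a F.< c
first<last (inj₁ (a<b , b<c)) = NP.<-trans a<b b<c
first<last (inj₂ (inj₁ (a<c , _))) = a<c
first<last (inj₂ (inj₂ (_ , a<c))) = a<c

Between : Fin n → Fin n → Fin n → Set
Between i k y = toℕ i ≤ toℕ y × toℕ y ≤ toℕ k

SameSide : ℕ → Fin n → Fin n → Set
SameSide c x y = (toℕ x < c → toℕ y < c) × (c ≤ toℕ x → c ≤ toℕ y)

triple-source : {w : Word n} {i j k z : Fin n} → i F.< j → j F.< k →
  z ∈ (lookup w i L.∷ lookup w j L.∷ lookup w k L.∷ L.[]) → ∃[ y ] z ≡ lookup w y × Between i k y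
triple-source {i = i} i<j j<k (here e) = i , e , NP.≤-refl , NP.<⇒≤ (NP.<-trans i<j j<k)
triple-source {j = j} i<j j<k (there (here e)) = j , e , NP.<⇒≤ i<j , NP.<⇒≤ j<k
triple-source {k = k} i<j j<k (there (there (here e))) = k , e , NP.<⇒≤ (NP.<-trans i<j j<k) , NP.≤-refl

-- A triple with pattern in Π never straddles a cut, as its first letter is
-- smaller than its last one.
window-side : {w : Word n} {c : ℕ} {i j k : Fin n} → Cut w c →
  InΠ (lookup w i) (lookup w j) (lookup w k) → toℕ k < c ⊎ c ≤ toℕ i
window-side {c = c} {i} {k = k} cut P with toℕ k NP.<? c | toℕ i NP.<? c
... | yes k<c | _ = inj₁ k<c
... | no _ | no i≮c = inj₂ (NP.≮⇒≥ i≮c)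
... | no k≮c | yes i<c = ⊥-elim (NP.<-asym (first<last P) (cut i k i<c (NP.≮⇒≥ k≮c)))

window-same-side : {c : ℕ} {i k x y : Fin n} → toℕ k < c ⊎ c ≤ toℕ i →
  Between i k x → Between i k y → SameSide c x y
window-same-side (inj₁ k<c) (_ , x≤k) (_ , y≤k) =
  (λ _ → NP.≤-<-trans y≤k k<c) , (λ c≤x → ⊥-elim (NP.<⇒≱ k<c (NP.≤-trans c≤x x≤k)))
window-same-side (inj₂ c≤i) (i≤x , _) (i≤y , _) =
  (λ x<c → ⊥-elim (NP.<⇒≱ x<c (NP.≤-trans c≤i i≤x))) , (λ _ → NP.≤-trans c≤i i≤y)

-- A move only permutes the letters of its window, so every letter of w′ comes
-- from a position of w on the same side of a cut of w.
move-source : {w w′ : Word n} {c : ℕ} → Cut w c → Move w w′ → (x : Fin n) →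
  ∃[ y ] lookup w′ x ≡ lookup w y × SameSide c x y
move-source {w = w} cut (i , j , k , i<j , j<k , P , _ , w′↭w , rest) x
  with window-side {w = w} cut P | x FP.≟ i | x FP.≟ j | x FP.≟ k
... | side | yes refl | _ | _ =
  let y , e , y∈ = triple-source {w = w} i<j j<k (∈-resp-↭ w′↭w (here refl))
  in y , e , window-same-side side (NP.≤-refl , NP.<⇒≤ (NP.<-trans i<j j<k)) y∈
... | side | no _ | yes refl | _ =
  let y , e , y∈ = triple-source {w = w} i<j j<k (∈-resp-↭ w′↭w (there (here refl)))
  in y , e , window-same-side side (NP.<⇒≤ i<j , NP.<⇒≤ j<k) y∈
... | side | no _ | no _ | yes refl =
  let y , e , y∈ = triple-source {w = w} i<j j<k (∈-resp-↭ w′↭w (there (there (here refl))))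
  in y , e , window-same-side side (NP.<⇒≤ (NP.<-trans i<j j<k) , NP.≤-refl) y∈
... | _ | no x≢i | no x≢j | no x≢k = x , rest x x≢i x≢j x≢k , (λ x<c → x<c) , (λ c≤x → c≤x)

cut-move : {w w′ : Word n} {c : ℕ} → Move w w′ → Cut w c → Cut w′ c
cut-move {w = w} {w′} m cut p q p<c c≤q
  with move-source {w = w} {w′} cut m p | move-source {w = w} {w′} cut m q
... | yp , ep , below , _ | yq , eq , _ , above =
  subst₂ F._<_ (sym eq) (sym ep) (cut yp yq (below p<c) (above c≤q))

cut-step : {w w′ : Word n} {c : ℕ} → SymClosure Move w w′ → Cut w c → Cut w′ c
cut-step {w = w} {w′} (fwd m) = cut-move {w = w} {w′} m
cut-step {w = w} {w′} (bwd m) = cut-move {w = w} {w′} (move-sym {w = w′} {w} m)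

cut-equiv : {w w′ : Word n} {c : ℕ} → Equiv w w′ → Cut w c → Cut w′ c
cut-equiv ε cut = cut
cut-equiv (step ◅ steps) cut = cut-equiv steps (cut-step step cut)

prepend : Fin (suc k) → Vec (Fin k) k → Word (suc k)
prepend x r = x ∷ map (punchIn x) r

lookup-prepend : (x : Fin (suc k)) (r : Vec (Fin k) k) (q : Fin k) →
  lookup (prepend x r) (fs q) ≡ punchIn x (lookup r q)
lookup-prepend x r q = VP.lookup-map q (punchIn x) r

prepend-perm : (x : Fin (suc k)) (r : Vec (Fin k) k) → IsPerm r → IsPerm (prepend x r)
prepend-perm x r pr fz fz e = refl
prepend-perm x r pr fz (fs q) e = ⊥-elim (FP.punchInᵢ≢i x (lookup r q) (sym (trans e (lookup-prepend x r q))))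
prepend-perm x r pr (fs p) fz e = ⊥-elim (FP.punchInᵢ≢i x (lookup r p) (trans (sym (lookup-prepend x r p)) e))
prepend-perm x r pr (fs p) (fs q) e =
  cong fs (pr p q (FP.punchIn-injective x _ _
    (trans (sym (lookup-prepend x r p)) (trans e (lookup-prepend x r q)))))

prepend-view : (t : Word (suc (suc k))) → IsPerm t →
  ∃[ x ] ∃[ u ] t ≡ prepend x u × IsPerm u
prepend-view {k} (x ∷ rest) pt = x , u , cong (x ∷_) (Pointwise-≡⇒≡ (ext rest≗)) , pu
  where
    x≢ : ∀ q → x ≢ lookup rest q
    x≢ q e with pt fz (fs q) e
    ... | ()
    u : Word (suc k)
    u = tabulate (λ q → punchOut (x≢ q))
    lookup-u : ∀ q → lookup u q ≡ punchOut (x≢ q)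
    lookup-u = VP.lookup∘tabulate (λ q → punchOut (x≢ q))
    rest≗ : ∀ q → lookup rest q ≡ lookup (map (punchIn x) u) q
    rest≗ q = sym (begin
      lookup (map (punchIn x) u) q ≡⟨ VP.lookup-map q (punchIn x) u ⟩
      punchIn x (lookup u q)       ≡⟨ cong (punchIn x) (lookup-u q) ⟩
      punchIn x (punchOut (x≢ q))  ≡⟨ FP.punchIn-punchOut (x≢ q) ⟩
      lookup rest q                ∎)
      where open ≡-Reasoning
    pu : IsPerm u
    pu p q e = FP.suc-injective (pt (fs p) (fs q)
      (FP.punchOut-injective (x≢ p) (x≢ q) (trans (sym (lookup-u p)) (trans e (lookup-u q)))))

cut-tail : (x : Fin (suc k)) (r : Vec (Fin k) k) (c : ℕ) → Cut (prepend x r) (suc c) → Cut r c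
cut-tail x r c cut p q p<c c≤q = punchIn-cancel-< x
  (subst₂ F._<_ (lookup-prepend x r q) (lookup-prepend x r p) (cut (fs p) (fs q) (s≤s p<c) (s≤s c≤q)))

cut-prepend : (x : Fin (suc k)) (r : Vec (Fin k) k) (c : ℕ) → Cut r c →
  ((q : Fin k) → c ≤ toℕ q → punchIn x (lookup r q) F.< x) → Cut (prepend x r) (suc c)
cut-prepend x r c cut x-above fz fz _ ()
cut-prepend x r c cut x-above fz (fs q) _ (s≤s c≤q) =
  subst (F._< x) (sym (lookup-prepend x r q)) (x-above q c≤q)
cut-prepend x r c cut x-above (fs p) fz _ ()
cut-prepend x r c cut x-above (fs p) (fs q) (s≤s p<c) (s≤s c≤q) =
  subst₂ F._<_ (sym (lookup-prepend x r q)) (sym (lookup-prepend x r p)) (punchIn-mono-< x (cut p q p<c c≤q))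

-- The first letter of a representative: the largest letter (bit set: a cut
-- after it) or the letter just below the next one (bit clear: no cut there).
firstLetter : Bool → Word (suc k) → Fin (suc (suc k))
firstLetter true r = fromℕ _
firstLetter false r = inject₁ (lookup r fz)

-- The representative with cut set encoded by bs.
rep : (m : ℕ) → Vec Bool m → Word (suc m)
rep zero [] = fz ∷ []
rep (suc m) (b ∷ bs) = prepend (firstLetter b (rep m bs)) (rep m bs)

rep-perm : (m : ℕ) (bs : Vec Bool m) → IsPerm (rep m bs)
rep-perm zero [] fz fz _ = refl
rep-perm (suc m) (b ∷ bs) = prepend-perm _ _ (rep-perm m bs)

below-top : (y : Fin (suc k)) → punchIn (fromℕ (suc k)) y F.< fromℕ (suc k)
below-top {k} y = punchIn-below _ y (subst (toℕ y <_) (sym (FP.toℕ-fromℕ (suc k))) (FP.toℕ<n y))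

below-first : (r : Word (suc k)) {c : ℕ} → Cut r (suc c) → (q : Fin (suc k)) → suc c ≤ toℕ q →
  punchIn (inject₁ (lookup r fz)) (lookup r q) F.< inject₁ (lookup r fz)
below-first r cut q c<q = punchIn-below _ (lookup r q)
  (subst (toℕ (lookup r q) <_) (sym (FP.toℕ-inject₁ (lookup r fz))) (cut fz q (s≤s z≤n) c<q))

rep-cut : (m : ℕ) (bs : Vec Bool m) (i : Fin m) → lookup bs i ≡ true → Cut (rep m bs) (suc (toℕ i))
rep-cut (suc m) (true ∷ bs) fz _ = cut-prepend _ _ 0 (λ p q ()) (λ q _ → below-top _)
rep-cut (suc m) (b ∷ bs) (fs i) bit = cut-prepend _ _ (suc (toℕ i)) (rep-cut m bs i bit) (first-above b)
  where
    first-above : (b : Bool) (q : Fin (suc m)) → suc (toℕ i) ≤ toℕ q →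
      punchIn (firstLetter b (rep m bs)) (lookup (rep m bs) q) F.< firstLetter b (rep m bs)
    first-above true q _ = below-top _
    first-above false q i<q = below-first (rep m bs) (rep-cut m bs i bit) q i<q

-- A clear bit i means letters i and i+1 of the representative form an ascent,
-- which no cut separates.
rep-no-cut : (m : ℕ) (bs : Vec Bool m) (i : Fin m) → lookup bs i ≡ false → ¬ Cut (rep m bs) (suc (toℕ i))
rep-no-cut (suc m) (false ∷ bs) fz _ cut = NP.<-asym second<first first<second
  where
    r : Word (suc m)
    r = rep m bs
    x : Fin (suc (suc m))
    x = inject₁ (lookup r fz)
    second<first : punchIn x (lookup r fz) F.< x
    second<first = subst (F._< x) (lookup-prepend x r fz) (cut fz (fs fz) (s≤s z≤n) (s≤s z≤n))
    first<second : x F.< punchIn x (lookup r fz)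
    first<second = punchIn-above x (lookup r fz) (NP.≤-reflexive (FP.toℕ-inject₁ (lookup r fz)))
rep-no-cut (suc m) (b ∷ bs) (fs i) bit cut = rep-no-cut m bs i bit (cut-tail _ _ (suc (toℕ i)) cut)

-- Equivalent representatives have equal bit-vectors, since their cuts agree.
rep-injective : (m : ℕ) {bs bs′ : Vec Bool m} → Equiv (rep m bs) (rep m bs′) → bs ≡ bs′
rep-injective m {bs} {bs′} eq = Pointwise-≡⇒≡ (ext same-bit)
  where
    same-bit : (i : Fin m) → lookup bs i ≡ lookup bs′ i
    same-bit i with lookup bs i in bit | lookup bs′ i in bit′
    ... | true | true = refl
    ... | false | false = refl
    ... | true | false = ⊥-elim (rep-no-cut m bs′ i bit′ (cut-equiv eq (rep-cut m bs i bit)))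
    ... | false | true = ⊥-elim (rep-no-cut m bs i bit (cut-equiv (symmetric Move eq) (rep-cut m bs′ i bit′)))

Layered : Word n → Set
Layered {n} w = (p q : Fin n) → p F.< q → lookup w q F.< lookup w p →
  ∃[ c ] toℕ p < c × c ≤ toℕ q × Cut w c

layered-tail : (x : Fin (suc k)) (u : Vec (Fin k) k) → Layered (prepend x u) → Layered u
layered-tail x u layered p q p<q q<p
  with layered (fs p) (fs q) (s≤s p<q)
         (subst₂ F._<_ (sym (lookup-prepend x u q)) (sym (lookup-prepend x u p)) (punchIn-mono-< x q<p))
... | suc c , s≤s p<c , s≤s c≤q , cut = c , p<c , c≤q , cut-tail x u c cut

cut₁-first-top : {t : Word (suc k)} → IsPerm t → Cut t 1 → lookup t fz ≡ fromℕ k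
cut₁-first-top {k} {t} pt cut with perm-surjective {w = t} pt (fromℕ k)
... | fz , top = top
... | fs q , top = ⊥-elim (NP.<⇒≱ (subst (F._< lookup t fz) top (cut fz (fs q) (s≤s z≤n) (s≤s z≤n)))
                                   (FP.≤fromℕ (lookup t fz)))

-- In a layered permutation starting with an ascent, the second letter is the
-- successor of the first: otherwise that successor sits further right, below
-- the second letter, and the cut separating this inversion would also put it
-- below the first letter.
ascent-successor : {t : Word (suc (suc k))} → IsPerm t → Layered t →
  lookup t fz F.< lookup t (fs fz) → toℕ (lookup t (fs fz)) ≡ suc (toℕ (lookup t fz))
ascent-successor {k} {t} pt layered t₀<t₁ = locate (perm-surjective {w = t} pt s)
  where
    t₀ t₁ : Fin (suc (suc k))
    t₀ = lookup t fz
    t₁ = lookup t (fs fz)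
    s<n : suc (toℕ t₀) < suc (suc k)
    s<n = NP.≤-<-trans t₀<t₁ (FP.toℕ<n t₁)
    s : Fin (suc (suc k))
    s = fromℕ< s<n
    toℕ-at : {p : Fin (suc (suc k))} → lookup t p ≡ s → toℕ (lookup t p) ≡ suc (toℕ t₀)
    toℕ-at e = trans (cong toℕ e) (FP.toℕ-fromℕ< s<n)
    below-second : (q : Fin k) → lookup t (fs (fs q)) ≡ s → lookup t (fs (fs q)) F.< t₁
    below-second q e = FP.≤∧≢⇒< (subst (_≤ toℕ t₁) (sym (toℕ-at e)) t₀<t₁)
      (λ e′ → FP.0≢1+n (sym (FP.suc-injective (pt (fs (fs q)) (fs fz) e′))))
    locate : ∃[ p ] lookup t p ≡ s → toℕ t₁ ≡ suc (toℕ t₀)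
    locate (fz , e) = ⊥-elim (NP.1+n≢n (sym (toℕ-at e)))
    locate (fs fz , e) = toℕ-at e
    locate (fs (fs q) , e) with layered (fs fz) (fs (fs q)) (s≤s (s≤s z≤n)) (below-second q e)
    ... | suc zero , s≤s () , _
    ... | suc (suc c) , _ , c≤p , cut =
      ⊥-elim (NP.<-asym (cut fz (fs (fs q)) (s≤s z≤n) c≤p)
                        (subst (toℕ t₀ <_) (sym (toℕ-at e)) (NP.n<1+n _)))

successor-first : (x : Fin (suc k)) (y : Fin k) → x F.< punchIn x y →
  toℕ (punchIn x y) ≡ suc (toℕ x) → x ≡ inject₁ y
successor-first x y x<x′ x′≡1+x with toℕ y NP.<? toℕ x
... | yes y<x = ⊥-elim (NP.<-asym x<x′ (punchIn-below x y y<x))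
... | no y≮x = FP.toℕ-injective (begin
  toℕ x           ≡⟨ NP.suc-injective (trans (sym x′≡1+x) (toℕ-punchIn-≥ x y (NP.≮⇒≥ y≮x))) ⟩
  toℕ y           ≡⟨ sym (FP.toℕ-inject₁ y) ⟩
  toℕ (inject₁ y) ∎)
  where open ≡-Reasoning

-- The first letter of a layered permutation prepend x u is a first letter of a
-- representative over u: the top letter after a descent, the letter below the
-- next one after an ascent.
first-letter : (x : Fin (suc (suc k))) (u : Word (suc k)) → IsPerm (prepend x u) → Layered (prepend x u) →
  ∃[ b ] x ≡ firstLetter b u
first-letter x u pt layered with FP.<-cmp x (punchIn x (lookup u fz))
... | tri< x<t₁ _ _ = false , successor-first x (lookup u fz) x<t₁
  (trans (cong toℕ (sym (lookup-prepend x u fz)))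
         (ascent-successor {t = prepend x u} pt layered (subst (x F.<_) (sym (lookup-prepend x u fz)) x<t₁)))
... | tri≈ _ x≡t₁ _ = ⊥-elim (FP.punchInᵢ≢i x (lookup u fz) (sym x≡t₁))
... | tri> _ _ t₁<x with layered fz (fs fz) (s≤s z≤n) (subst (F._< x) (sym (lookup-prepend x u fz)) t₁<x)
...   | suc zero , _ , _ , cut = true , cut₁-first-top {t = prepend x u} pt cut
...   | suc (suc _) , _ , s≤s () , _

layered-rep : (m : ℕ) (t : Word (suc m)) → IsPerm t → Layered t → ∃[ bs ] t ≡ rep m bs
layered-rep zero (fz ∷ []) _ _ = [] , refl
layered-rep (suc m) t pt layered with prepend-view t pt
... | x , u , refl , pu with layered-rep m u pu (layered-tail x u layered) | first-letter x u pt layered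
...   | bs , refl | b , refl = b ∷ bs , refl

-- An inversion j<k of w is reducible when it is the "32" of a 132 (some i<j
-- with w i < w k) or the "21" of a 213 (some l>k with w j < w l).
Reducible : Word n → Fin n → Fin n → Set
Reducible w j k = j F.< k × lookup w k F.< lookup w j ×
  ((∃[ i ] i F.< j × lookup w i F.< lookup w k) ⊎ (∃[ l ] k F.< l × lookup w j F.< lookup w l))

Irreducible : Word n → Set
Irreducible w = ¬ (∃[ j ] ∃[ k ] Reducible w j k)

reducible? : (w : Word n) → Dec (∃[ j ] ∃[ k ] Reducible w j k)
reducible? w = FP.any? λ j → FP.any? λ k → (j FP.<? k) ×-dec ((lookup w k FP.<? lookup w j) ×-dec
  (FP.any? (λ i → (i FP.<? j) ×-dec (lookup w i FP.<? lookup w k))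
   ⊎-dec FP.any? (λ l → (k FP.<? l) ×-dec (lookup w j FP.<? lookup w l))))

swapAt : Word n → Fin n → Fin n → Word n
swapAt w j k = tabulate (λ p → lookup w (transpose j k p))

lookup-swapAt : (w : Word n) (j k p : Fin n) → lookup (swapAt w j k) p ≡ lookup w (transpose j k p)
lookup-swapAt w j k = VP.lookup∘tabulate (λ p → lookup w (transpose j k p))

swapAt-j : (w : Word n) (j k : Fin n) → lookup (swapAt w j k) j ≡ lookup w k
swapAt-j w j k rewrite lookup-swapAt w j k j | dec-true (j FP.≟ j) refl = refl

swapAt-k : (w : Word n) (j k : Fin n) → lookup (swapAt w j k) k ≡ lookup w j
swapAt-k w j k rewrite lookup-swapAt w j k k with k FP.≟ j
... | yes refl = refl
... | no _ rewrite dec-true (k FP.≟ k) refl = refl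

swapAt-other : (w : Word n) (j k p : Fin n) → p ≢ j → p ≢ k → lookup (swapAt w j k) p ≡ lookup w p
swapAt-other w j k p p≢j p≢k
  rewrite lookup-swapAt w j k p | dec-false (p FP.≟ j) p≢j | dec-false (p FP.≟ k) p≢k = refl

swapAt-perm : (w : Word n) (j k : Fin n) → IsPerm w → IsPerm (swapAt w j k)
swapAt-perm w j k pw p q e = begin
  p                                   ≡⟨ sym (transpose-inverse k j) ⟩
  transpose k j (transpose j k p)     ≡⟨ cong (transpose k j) (pw _ _ same-letter) ⟩
  transpose k j (transpose j k q)     ≡⟨ transpose-inverse k j ⟩
  q                                   ∎
  where
    open ≡-Reasoning
    same-letter : lookup w (transpose j k p) ≡ lookup w (transpose j k q)
    same-letter = trans (sym (lookup-swapAt w j k p)) (trans e (lookup-swapAt w j k q))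

mkMove : {w w′ : Word n} {i j k a b c : Fin n} → i F.< j → j F.< k →
  InΠ (lookup w i) (lookup w j) (lookup w k) →
  lookup w′ i ≡ a → lookup w′ j ≡ b → lookup w′ k ≡ c → InΠ a b c →
  (a L.∷ b L.∷ c L.∷ L.[]) ↭ (lookup w i L.∷ lookup w j L.∷ lookup w k L.∷ L.[]) →
  ((p : Fin n) → p ≢ i → p ≢ j → p ≢ k → lookup w′ p ≡ lookup w p) → Move w w′
mkMove {i = i} {j} {k} i<j j<k P refl refl refl P′ abc↭ rest = i , j , k , i<j , j<k , P , P′ , abc↭ , rest

-- Swapping a reducible inversion is a move: 132 becomes 123, or 213 becomes 123.
swap-move : (w : Word n) (j k : Fin n) → Reducible w j k → Move w (swapAt w j k)
swap-move w j k (j<k , k<j , inj₁ (i , i<j , i<k)) =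
  mkMove {w = w} {swapAt w j k} i<j j<k (inj₂ (inj₁ (i<k , k<j)))
    (swapAt-other w j k i (FP.<⇒≢ i<j) (FP.<⇒≢ (NP.<-trans i<j j<k))) (swapAt-j w j k) (swapAt-k w j k)
    (inj₁ (i<k , k<j)) (prep _ (swap _ _ ↭-refl)) (λ p _ p≢j p≢k → swapAt-other w j k p p≢j p≢k)
swap-move w j k (j<k , k<j , inj₂ (l , k<l , j<l)) =
  mkMove {w = w} {swapAt w j k} j<k k<l (inj₂ (inj₂ (k<j , j<l)))
    (swapAt-j w j k) (swapAt-k w j k)
    (swapAt-other w j k l (λ e → FP.<⇒≢ (NP.<-trans j<k k<l) (sym e)) (λ e → FP.<⇒≢ k<l (sym e)))
    (inj₁ (k<j , j<l)) (swap _ _ ↭-refl) (λ p p≢j p≢k _ → swapAt-other w j k p p≢j p≢k)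

LexLess : Word n → Word n → Set
LexLess = Lex-< _≡_ F._<_

lexLess-wellFounded : WellFounded (LexLess {n})
lexLess-wellFounded = Lex.<-wellFounded trans (λ { refl h → h }) FI.<-wellFounded

lex-at : {A : Set} {_≺_ : A → A → Set} (v′ v : Vec A k) (j : Fin k) →
  ((i : Fin k) → toℕ i < toℕ j → lookup v′ i ≡ lookup v i) → lookup v′ j ≺ lookup v j →
  Lex-< _≡_ _≺_ v′ v
lex-at (x′ ∷ v′) (x ∷ v) fz _ x′≺x = this x′≺x refl
lex-at (x′ ∷ v′) (x ∷ v) (fs j) agree ≺ =
  next (agree fz (s≤s z≤n)) (lex-at v′ v j (λ i i<j → agree (fs i) (s≤s i<j)) ≺)

swap-lexLess : (w : Word n) (j k : Fin n) → j F.< k → lookup w k F.< lookup w j → LexLess (swapAt w j k) w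
swap-lexLess w j k j<k k<j = lex-at (swapAt w j k) w j
  (λ i i<j → swapAt-other w j k i (FP.<⇒≢ i<j) (FP.<⇒≢ (NP.<-trans i<j j<k)))
  (subst (F._< lookup w j) (sym (swapAt-j w j k)) k<j)

normalise : (w : Word n) → Acc LexLess w → IsPerm w → ∃[ t ] Equiv w t × IsPerm t × Irreducible t
normalise w (acc smaller) pw with reducible? w
... | no irreducible = w , ε , pw , irreducible
... | yes (j , k , red@(j<k , k<j , _)) =
  let t , w′~t , pt , irr =
        normalise (swapAt w j k) (smaller (swap-lexLess w j k j<k k<j)) (swapAt-perm w j k pw)
  in t , fwd (swap-move w j k red) ◅ w′~t , pt , irr

adjacent-descent : {m : ℕ} (f : Fin (suc n) → Fin m) (p q : Fin (suc n)) → p F.< q → f q F.< f p →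
  ∃[ d ] toℕ p ≤ toℕ d × suc (toℕ d) ≤ toℕ q × f (fs d) F.< f (inject₁ d)
adjacent-descent {zero} f fz fz () _
adjacent-descent {suc n} f (fs p) (fs q) (s≤s p<q) fq<fp with adjacent-descent (λ x → f (fs x)) p q p<q fq<fp
... | d , p≤d , d<q , descent = fs d , s≤s p≤d , s≤s d<q , descent
adjacent-descent {suc n} f fz (fs q) _ fq<f0 with f (fs fz) FP.<? f fz
... | yes descent = fz , z≤n , s≤s z≤n , descent
... | no f1≮f0 with q
...   | fz = ⊥-elim (f1≮f0 fq<f0)
...   | fs q′ with adjacent-descent (λ x → f (fs x)) fz (fs q′) (s≤s z≤n)
                    (NP.<-≤-trans fq<f0 (NP.≮⇒≥ f1≮f0))
...     | d , _ , d<q , descent = fs d , z≤n , s≤s d<q , descent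

-- In an irreducible permutation an inversion j<k stays an inversion when j is
-- moved left or k is moved right (otherwise it would be reducible).
inversion-left : {w : Word n} → IsPerm w → Irreducible w → {i j k : Fin n} → j F.< k →
  lookup w k F.< lookup w j → toℕ i ≤ toℕ j → lookup w k F.< lookup w i
inversion-left {w = w} pw irr {i} {j} {k} j<k k<j i≤j with NP.m≤n⇒m<n∨m≡n i≤j
... | inj₂ i≡j = subst (λ x → lookup w k F.< lookup w x) (sym (FP.toℕ-injective i≡j)) k<j
... | inj₁ i<j = perm-flip {w = w} pw (FP.<⇒≢ (NP.<-trans i<j j<k))
  (λ i<k → irr (j , k , j<k , k<j , inj₁ (i , i<j , i<k)))

inversion-right : {w : Word n} → IsPerm w → Irreducible w → {j k l : Fin n} → j F.< k →
  lookup w k F.< lookup w j → toℕ k ≤ toℕ l → lookup w l F.< lookup w j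
inversion-right {w = w} pw irr {j} {k} {l} j<k k<j k≤l with NP.m≤n⇒m<n∨m≡n k≤l
... | inj₂ k≡l = subst (λ x → lookup w x F.< lookup w j) (FP.toℕ-injective k≡l) k<j
... | inj₁ k<l = perm-flip {w = w} pw (FP.<⇒≢ (NP.<-trans j<k k<l))
  (λ j<l → irr (j , k , j<k , k<j , inj₂ (l , k<l , j<l)))

descent-cut : {w : Word (suc n)} → IsPerm w → Irreducible w → (d : Fin n) →
  lookup w (fs d) F.< lookup w (inject₁ d) → Cut w (suc (toℕ d))
descent-cut {w = w} pw irr d descent a b a<c c≤b =
  inversion-right {w = w} pw irr a<d+1 (inversion-left {w = w} pw irr d<d+1 descent a≤d) c≤b
  where
    d<d+1 : inject₁ d F.< fs d
    d<d+1 = s≤s (NP.≤-reflexive (FP.toℕ-inject₁ d))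
    a≤d : toℕ a ≤ toℕ (inject₁ d)
    a≤d = subst (toℕ a ≤_) (sym (FP.toℕ-inject₁ d)) (NP.≤-pred a<c)
    a<d+1 : a F.< fs d
    a<d+1 = a<c

irreducible-layered : {w : Word n} → IsPerm w → Irreducible w → Layered w
irreducible-layered {suc n} {w} pw irr p q p<q q<p with adjacent-descent (lookup w) p q p<q q<p
... | d , p≤d , d<q , descent = suc (toℕ d) , s≤s p≤d , d<q , descent-cut {w = w} pw irr d descent

equiv-rep : (m : ℕ) (w : Word (suc m)) → IsPerm w → ∃[ bs ] Equiv w (rep m bs)
equiv-rep m w pw =
  let t , w~t , pt , irr = normalise w (lexLess-wellFounded w) pw
      bs , t≡rep = layered-rep m t pt (irreducible-layered {w = t} pt irr)
  in bs , subst (Equiv w) t≡rep w~t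

bitVectors : (m : ℕ) → List (Vec Bool m)
bitVectors zero = [] L.∷ L.[]
bitVectors (suc m) = L.map (true ∷_) (bitVectors m) ++ L.map (false ∷_) (bitVectors m)

bitVectors-length : (m : ℕ) → length (bitVectors m) ≡ 2 ^ m
bitVectors-length zero = refl
bitVectors-length (suc m) = begin
  length (L.map (true ∷_) (bitVectors m) ++ L.map (false ∷_) (bitVectors m))
    ≡⟨ length-++ (L.map (true ∷_) (bitVectors m)) ⟩
  length (L.map (true ∷_) (bitVectors m)) + length (L.map (false ∷_) (bitVectors m))
    ≡⟨ cong₂ _+_ (length-map _ (bitVectors m)) (length-map _ (bitVectors m)) ⟩
  length (bitVectors m) + length (bitVectors m)
    ≡⟨ cong₂ _+_ (bitVectors-length m) (trans (bitVectors-length m) (sym (NP.+-identityʳ (2 ^ m)))) ⟩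
  2 ^ suc m ∎
  where open ≡-Reasoning

bitVectors-complete : (m : ℕ) (bs : Vec Bool m) → bs ∈ bitVectors m
bitVectors-complete zero [] = here refl
bitVectors-complete (suc m) (true ∷ bs) =
  AnyP.++⁺ˡ (AnyP.map⁺ (Any.map (cong (true ∷_)) (bitVectors-complete m bs)))
bitVectors-complete (suc m) (false ∷ bs) =
  AnyP.++⁺ʳ (L.map (true ∷_) (bitVectors m)) (AnyP.map⁺ (Any.map (cong (false ∷_)) (bitVectors-complete m bs)))

bitVectors-distinct : (m : ℕ) → AllPairs _≢_ (bitVectors m)
bitVectors-distinct zero = All.[] AP.∷ AP.[]
bitVectors-distinct (suc m) =
  APP.++⁺ (APP.map⁺ (AP.map (λ ne e → ne (VP.∷-injectiveʳ e)) (bitVectors-distinct m)))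
          (APP.map⁺ (AP.map (λ ne e → ne (VP.∷-injectiveʳ e)) (bitVectors-distinct m)))
          (AllP.map⁺ (All.universal (λ _ → AllP.map⁺ (All.universal (λ _ ()) (bitVectors m)))
                                    (bitVectors m)))

theorem2p8 : (n : ℕ) → 1 ≤ n →
    Σ (List (Word n)) (λ reps →
      (length reps ≡ 2 ^ (n ∸ 1))
      × All IsPerm reps
      × AllPairs (λ u v → ¬ Equiv u v) reps
      × ((w : Word n) → IsPerm w → Any (Equiv w) reps))
theorem2p8 (suc m) _ =
  L.map (rep m) (bitVectors m) ,
  trans (length-map (rep m) (bitVectors m)) (bitVectors-length m) ,
  AllP.map⁺ (All.universal (rep-perm m) (bitVectors m)) ,
  APP.map⁺ (AP.map (λ bs≢bs′ equiv → bs≢bs′ (rep-injective m equiv)) (bitVectors-distinct m)) ,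
  λ w pw → let bs , w~rep = equiv-rep m w pw in
    AnyP.map⁺ (Any.map (λ { refl → w~rep }) (bitVectors-complete m bs))
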